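{- Let $n$ be a positive integer. There is no family $\mathcal{F}\subset\binom{[n+2]}{2}$ such that both (i) for each $S\in\binom{[n+2]}{1}$, $\mathcal{F}$ contains at least $2$ supersets of $S$, and (ii) for each $T\in\binom{[n+2]}{3}$, $\mathcal{F}$ contains at most $1$ subset of $T$. Moreover, there is no family $\mathcal{F}\subset\binom{[n+2]}{2}$ such that, setting $\mathcal{B}=\{\emptyset\}\cup\mathcal{F}\cup\binom{[n+2]}{3}$ and $\mathcal{R}=\mathcal{Q}_{n+2}\setminus\mathcal{B}$, the poset $\mathcal{Q}_2$ is not a weak subposet of $\mathcal{B}$ and $\mathcal{Q}_n$ is not a weak subposet of $\mathcal{R}$.
   Context: $[N]=\{1,\dots,N\}$; $\binom{S}{j}$ denotes the family of all $j$-element subsets of $S$. The Boolean lattice $\mathcal{Q}_N$ is the power set of $[N]$ ordered by inclusion; subfamilies are ordered by inclusion. For posets $P$ and $Q$, $P$ is a weak subposet of $Q$ if there is an injection $f:P\to Q$ such that $f(x)\le f(y)$ whenever $x\le y$. -}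

module Defs where

open import Data.Nat using (ℕ; suc; _≤_)
open import Data.Fin.Subset using (Subset; _⊆_; ∣_∣; ⊥)
open import Data.Product using (Σ; ∃; _×_; _,_)
open import Data.Sum using (_⊎_)
open import Relation.Binary.PropositionalEquality using (_≡_)
open import Relation.Nullary using (¬_)
open import Function.Definitions using (Injective)
open import Level using (0ℓ)
open import Relation.Unary using (Pred)

Family : ℕ → Set₁
Family N = Pred (Subset N) 0ℓ

_⊆Layer_ : ∀ {N} → Family N → ℕ → Set
F ⊆Layer k = ∀ A → F A → ∣ A ∣ ≡ k

AtLeast2Supersets : ∀ {N} → Family N → Subset N → Set
AtLeast2Supersets F S =
  Σ _ λ A → Σ _ λ B → F A × F B × ¬ (A ≡ B) × S ⊆ A × S ⊆ B

AtMost1Subset : ∀ {N} → Family N → Subset N → Set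
AtMost1Subset F T = ∀ A B → F A → F B → A ⊆ T → B ⊆ T → A ≡ B

WeakSubposet : (m : ℕ) → ∀ {N} → Family N → Set
WeakSubposet m {N} P =
  Σ (Subset m → Subset N) λ f →
    Injective _≡_ _≡_ f × (∀ x → P (f x)) × (∀ x y → x ⊆ y → f x ⊆ f y)

BFam : ∀ {N} → Family N → Family N
BFam F A = (A ≡ ⊥) ⊎ F A ⊎ (∣ A ∣ ≡ 3)

RFam : ∀ {N} → Family N → Family N
RFam F A = ¬ BFam F A

{-# OPTIONS --safe #-}
-- Two distinct 2-sets A, B through a common point have ∣A ∪ B∣ = 3. So they violate (ii)
-- at T = A ∪ B, and ∅ ⊂ A, B ⊂ A ∪ B is a copy of Q₂ in B. In both halves F is therefore
-- pairwise disjoint, which already contradicts (i) at any point.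
-- For the second half choose q such that every member of F through the point 0 contains q
-- (the partner of 0 if 0 is covered). Then X ↦ {0} ∪ X ∪ ({q} if ∣X∣ ≥ 2), with X read in
-- the remaining n coordinates, is an order embedding of Qₙ whose images have sizes
-- 1, 2, 4, 5, …; its 2-sets are pairs at 0 avoiding q, so it lands in R.
module Submission where

open import Defs
open import Data.Nat using (ℕ; suc; _+_; _≤_; _<_; z≤n; s≤s)
open import Data.Nat.Properties
  using (+-comm; +-suc; +-cancelʳ-≡; ≤-trans; ≤-antisym; ≤-reflexive; ≤-pred; ≤∧≢⇒<; n≮n; suc-injective)
open import Data.Bool using (Bool; true; false)
import Data.Bool as Bool
import Data.Bool.Properties as Bool
open import Data.Fin using (Fin; zero; suc)
open import Data.Fin.Subset
  using (Subset; ∣_∣; _⊆_; _⊈_; _∈_; _∉_; _∪_; _∩_; ⁅_⁆; ⊥; Nonempty; inside; outside)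
open import Data.Fin.Subset.Properties
  using ( ⊥⊆; ⊆-refl; ⊆-trans; p⊆p∪q; q⊆p∪q; p∩q⊆p; p∩q⊆q; x∈p∩q⁺; x∈⁅x⁆; ∣⁅x⁆∣≡1
        ; out⊆; s⊆s; drop-∷-⊆; drop-there; p⊆q⇒∣p∣≤∣q∣; x∈p⇒∣p-x∣<∣p∣ )
open import Data.Vec using (_∷_; []; here; there; tail; insertAt; removeAt)
open import Data.Vec.Properties using (≡-dec; removeAt-insertAt; insertAt-lookup; []=⇒lookup)
open import Data.Product using (Σ; _×_; _,_)
open import Data.Sum using (inj₁; inj₂)
open import Data.Empty using (⊥-elim)
open import Function.Base using (_∘_)
open import Function.Bundles using (_⇔_; mk⇔)
open import Function.Definitions using (Injective)
import Function.Properties.Equivalence as ⇔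
open import Relation.Binary.Definitions using (DecidableEquality)
open import Relation.Binary.PropositionalEquality
  using (_≡_; _≢_; refl; sym; trans; cong; cong₂; subst; module ≡-Reasoning)
open import Relation.Nullary using (¬_; contradiction)
open import Relation.Nullary.Decidable using (decidable-stable)

private
  variable
    n N : ℕ

_≟_ : DecidableEquality (Subset n)
_≟_ = ≡-dec Bool._≟_

∣p∪q∣+∣p∩q∣≡∣p∣+∣q∣ : ∀ (p q : Subset n) → ∣ p ∪ q ∣ + ∣ p ∩ q ∣ ≡ ∣ p ∣ + ∣ q ∣
∣p∪q∣+∣p∩q∣≡∣p∣+∣q∣ []            []            = refl
∣p∪q∣+∣p∩q∣≡∣p∣+∣q∣ (outside ∷ p) (outside ∷ q) = ∣p∪q∣+∣p∩q∣≡∣p∣+∣q∣ p q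
∣p∪q∣+∣p∩q∣≡∣p∣+∣q∣ (inside ∷ p)  (outside ∷ q) = cong suc (∣p∪q∣+∣p∩q∣≡∣p∣+∣q∣ p q)
∣p∪q∣+∣p∩q∣≡∣p∣+∣q∣ (outside ∷ p) (inside ∷ q)  =
  trans (cong suc (∣p∪q∣+∣p∩q∣≡∣p∣+∣q∣ p q)) (sym (+-suc ∣ p ∣ ∣ q ∣))
∣p∪q∣+∣p∩q∣≡∣p∣+∣q∣ (inside ∷ p)  (inside ∷ q)  = cong suc (begin
  ∣ p ∪ q ∣ + suc ∣ p ∩ q ∣   ≡⟨ +-suc ∣ p ∪ q ∣ ∣ p ∩ q ∣ ⟩
  suc (∣ p ∪ q ∣ + ∣ p ∩ q ∣) ≡⟨ cong suc (∣p∪q∣+∣p∩q∣≡∣p∣+∣q∣ p q) ⟩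
  suc (∣ p ∣ + ∣ q ∣)         ≡⟨ +-suc ∣ p ∣ ∣ q ∣ ⟨
  ∣ p ∣ + suc ∣ q ∣           ∎)
  where open ≡-Reasoning

p⊆q⇒∣p∣≡∣q∣⇒p≡q : ∀ {p q : Subset n} → p ⊆ q → ∣ p ∣ ≡ ∣ q ∣ → p ≡ q
p⊆q⇒∣p∣≡∣q∣⇒p≡q {p = []}          {[]}          _   _ = refl
p⊆q⇒∣p∣≡∣q∣⇒p≡q {p = outside ∷ p} {outside ∷ q} p⊆q e =
  cong (outside ∷_) (p⊆q⇒∣p∣≡∣q∣⇒p≡q (drop-∷-⊆ p⊆q) e)
p⊆q⇒∣p∣≡∣q∣⇒p≡q {p = inside ∷ p}  {inside ∷ q}  p⊆q e =
  cong (inside ∷_) (p⊆q⇒∣p∣≡∣q∣⇒p≡q (drop-∷-⊆ p⊆q) (suc-injective e))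
p⊆q⇒∣p∣≡∣q∣⇒p≡q {p = outside ∷ p} {inside ∷ q}  p⊆q e =
  contradiction (subst (_≤ ∣ q ∣) e (p⊆q⇒∣p∣≤∣q∣ (drop-∷-⊆ p⊆q))) (n≮n ∣ q ∣)
p⊆q⇒∣p∣≡∣q∣⇒p≡q {p = inside ∷ p}  {outside ∷ q} p⊆q e = contradiction (p⊆q here) λ ()

∣p∣≡∣q∣⇒p≢q⇒p⊈q : ∀ {p q : Subset n} → ∣ p ∣ ≡ ∣ q ∣ → p ≢ q → p ⊈ q
∣p∣≡∣q∣⇒p≢q⇒p⊈q e p≢q p⊆q = p≢q (p⊆q⇒∣p∣≡∣q∣⇒p≡q p⊆q e)

Nonempty⇒0<∣p∣ : ∀ {p : Subset n} → Nonempty p → 0 < ∣ p ∣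
Nonempty⇒0<∣p∣ (_ , x∈p) = ≤-trans (s≤s z≤n) (x∈p⇒∣p-x∣<∣p∣ x∈p)

0<∣p∣⇒Nonempty : ∀ (p : Subset n) → 0 < ∣ p ∣ → Nonempty p
0<∣p∣⇒Nonempty (inside ∷ p)  _   = zero , here
0<∣p∣⇒Nonempty (outside ∷ p) 0<∣p∣ with 0<∣p∣⇒Nonempty p 0<∣p∣
... | x , x∈p = suc x , there x∈p

module _ {p q : Subset n} (∣p∣≡2 : ∣ p ∣ ≡ 2) (∣q∣≡2 : ∣ q ∣ ≡ 2) (p≢q : p ≢ q)
         {x : Fin n} (x∈p : x ∈ p) (x∈q : x ∈ q) where

  ∣p∩q∣≡1 : ∣ p ∩ q ∣ ≡ 1
  ∣p∩q∣≡1 = ≤-antisym (≤-pred (≤∧≢⇒< ∣p∩q∣≤2 ∣p∩q∣≢2))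
                      (Nonempty⇒0<∣p∣ (x , x∈p∩q⁺ (x∈p , x∈q)))
    where
    ∣p∩q∣≤2 : ∣ p ∩ q ∣ ≤ 2
    ∣p∩q∣≤2 = subst (∣ p ∩ q ∣ ≤_) ∣p∣≡2 (p⊆q⇒∣p∣≤∣q∣ (p∩q⊆p p q))
    ∣p∩q∣≢2 : ∣ p ∩ q ∣ ≢ 2
    ∣p∩q∣≢2 e = p≢q (trans (sym (p⊆q⇒∣p∣≡∣q∣⇒p≡q (p∩q⊆p p q) (trans e (sym ∣p∣≡2))))
                           (p⊆q⇒∣p∣≡∣q∣⇒p≡q (p∩q⊆q p q) (trans e (sym ∣q∣≡2))))

  ∣p∪q∣≡3 : ∣ p ∪ q ∣ ≡ 3
  ∣p∪q∣≡3 = +-cancelʳ-≡ 1 ∣ p ∪ q ∣ 3 (begin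
    ∣ p ∪ q ∣ + 1           ≡⟨ cong (∣ p ∪ q ∣ +_) ∣p∩q∣≡1 ⟨
    ∣ p ∪ q ∣ + ∣ p ∩ q ∣   ≡⟨ ∣p∪q∣+∣p∩q∣≡∣p∣+∣q∣ p q ⟩
    ∣ p ∣ + ∣ q ∣           ≡⟨ cong₂ _+_ ∣p∣≡2 ∣q∣≡2 ⟩
    4                       ∎)
    where open ≡-Reasoning

square : Subset N → Subset N → Subset 2 → Subset N
square A B (outside ∷ outside ∷ []) = ⊥
square A B (inside  ∷ outside ∷ []) = A
square A B (outside ∷ inside  ∷ []) = B
square A B (inside  ∷ inside  ∷ []) = A ∪ B

square-mono : ∀ (A B : Subset N) {a b} → a ⊆ b → square A B a ⊆ square A B b
square-mono A B {outside ∷ outside ∷ []} _ = ⊥⊆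
square-mono A B {inside  ∷ outside ∷ []} {inside  ∷ outside ∷ []} _ = ⊆-refl
square-mono A B {inside  ∷ outside ∷ []} {inside  ∷ inside  ∷ []} _ = p⊆p∪q B
square-mono A B {outside ∷ inside  ∷ []} {outside ∷ inside  ∷ []} _ = ⊆-refl
square-mono A B {outside ∷ inside  ∷ []} {inside  ∷ inside  ∷ []} _ = q⊆p∪q A B
square-mono A B {inside  ∷ inside  ∷ []} {inside  ∷ inside  ∷ []} _ = ⊆-refl
square-mono A B {inside  ∷ _ ∷ []} {outside ∷ _ ∷ []} a⊆b = contradiction (a⊆b here) λ ()
square-mono A B {_ ∷ inside  ∷ []} {_ ∷ outside ∷ []} a⊆b =
  contradiction (a⊆b (there here)) λ { (there ()) }

module _ {A B : Subset N} (A⊈B : A ⊈ B) (B⊈A : B ⊈ A) where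

  A⊆square⇔ : ∀ {a b} → A ⊆ square A B (a ∷ b ∷ []) ⇔ a ≡ inside
  A⊆square⇔ {outside} {outside} = mk⇔ (λ (A⊆⊥ : A ⊆ ⊥) → ⊥-elim (A⊈B (⊆-trans A⊆⊥ ⊥⊆))) λ ()
  A⊆square⇔ {outside} {inside}  = mk⇔ (λ (A⊆B : A ⊆ B) → ⊥-elim (A⊈B A⊆B)) λ ()
  A⊆square⇔ {inside}  {outside} = mk⇔ {A = A ⊆ A} (λ _ → refl) (λ _ → ⊆-refl)
  A⊆square⇔ {inside}  {inside}  = mk⇔ {A = A ⊆ A ∪ B} (λ _ → refl) (λ _ → p⊆p∪q B)

  B⊆square⇔ : ∀ {a b} → B ⊆ square A B (a ∷ b ∷ []) ⇔ b ≡ inside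
  B⊆square⇔ {outside} {outside} = mk⇔ (λ (B⊆⊥ : B ⊆ ⊥) → ⊥-elim (B⊈A (⊆-trans B⊆⊥ ⊥⊆))) λ ()
  B⊆square⇔ {inside}  {outside} = mk⇔ (λ (B⊆A : B ⊆ A) → ⊥-elim (B⊈A B⊆A)) λ ()
  B⊆square⇔ {outside} {inside}  = mk⇔ {A = B ⊆ B} (λ _ → refl) (λ _ → ⊆-refl)
  B⊆square⇔ {inside}  {inside}  = mk⇔ {A = B ⊆ A ∪ B} (λ _ → refl) (λ _ → q⊆p∪q A B)

  square-injective : Injective _≡_ _≡_ (square A B)
  square-injective {a₀ ∷ a₁ ∷ []} {b₀ ∷ b₁ ∷ []} e = cong₂ (λ a b → a ∷ b ∷ [])
    (Bool.⇔→≡ (⇔.trans (⇔.sym (A⊆square⇔ {a₀} {a₁}))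
      (subst (λ C → A ⊆ C ⇔ b₀ ≡ inside) (sym e) (A⊆square⇔ {b₀} {b₁}))))
    (Bool.⇔→≡ (⇔.trans (⇔.sym (B⊆square⇔ {a₀} {a₁}))
      (subst (λ C → B ⊆ C ⇔ b₁ ≡ inside) (sym e) (B⊆square⇔ {b₀} {b₁}))))

PairwiseDisjoint : Family N → Set
PairwiseDisjoint F = ∀ {A B x} → F A → F B → x ∈ A → x ∈ B → A ≡ B

PairwiseDisjoint⇒¬AtLeast2Supersets :
  ∀ {F : Family N} → PairwiseDisjoint F → (x : Fin N) → ¬ AtLeast2Supersets F ⁅ x ⁆
PairwiseDisjoint⇒¬AtLeast2Supersets disjoint x (A , B , FA , FB , A≢B , x⊆A , x⊆B) =
  A≢B (disjoint FA FB (x⊆A (x∈⁅x⁆ x)) (x⊆B (x∈⁅x⁆ x)))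

module _ {F : Family N} (layer : F ⊆Layer 2) where

  atMost1Subset⇒PairwiseDisjoint :
    (∀ T → ∣ T ∣ ≡ 3 → AtMost1Subset F T) → PairwiseDisjoint F
  atMost1Subset⇒PairwiseDisjoint atMost1 {A} {B} FA FB x∈A x∈B =
    decidable-stable (A ≟ B) λ A≢B →
      A≢B (atMost1 (A ∪ B) (∣p∪q∣≡3 (layer A FA) (layer B FB) A≢B x∈A x∈B)
                   A B FA FB (p⊆p∪q B) (q⊆p∪q A B))

  ¬Q₂⊑B⇒PairwiseDisjoint : ¬ WeakSubposet 2 (BFam F) → PairwiseDisjoint F
  ¬Q₂⊑B⇒PairwiseDisjoint ¬Q₂⊑B {A} {B} FA FB x∈A x∈B =
    decidable-stable (A ≟ B) (¬Q₂⊑B ∘ Q₂⊑B)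
    where
    ∣A∣≡∣B∣ : ∣ A ∣ ≡ ∣ B ∣
    ∣A∣≡∣B∣ = trans (layer A FA) (sym (layer B FB))

    Q₂⊑B : A ≢ B → WeakSubposet 2 (BFam F)
    Q₂⊑B A≢B = square A B , square-injective A⊈B B⊈A , square∈B , λ _ _ → square-mono A B
      where
      A⊈B : A ⊈ B
      A⊈B = ∣p∣≡∣q∣⇒p≢q⇒p⊈q ∣A∣≡∣B∣ A≢B
      B⊈A : B ⊈ A
      B⊈A = ∣p∣≡∣q∣⇒p≢q⇒p⊈q (sym ∣A∣≡∣B∣) (A≢B ∘ sym)
      square∈B : ∀ a → BFam F (square A B a)
      square∈B (outside ∷ outside ∷ []) = inj₁ refl
      square∈B (inside  ∷ outside ∷ []) = inj₂ (inj₁ FA)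
      square∈B (outside ∷ inside  ∷ []) = inj₂ (inj₁ FB)
      square∈B (inside  ∷ inside  ∷ []) =
        inj₂ (inj₂ (∣p∪q∣≡3 (layer A FA) (layer B FB) A≢B x∈A x∈B))

∷-⊆ : ∀ {s t} {p q : Subset n} → s Bool.≤ t → p ⊆ q → s ∷ p ⊆ t ∷ q
∷-⊆ Bool.f≤t p⊆q = out⊆ p⊆q
∷-⊆ Bool.b≤b p⊆q = s⊆s p⊆q

∷-⊆⇒≤ : ∀ {s t} {p q : Subset n} → s ∷ p ⊆ t ∷ q → s Bool.≤ t
∷-⊆⇒≤ {s = outside} _ = Bool.≤-minimum _
∷-⊆⇒≤ {s = inside} sp⊆tq with sp⊆tq here
... | here = Bool.b≤b

insertAt-⊆ : ∀ {s t} {p q : Subset n} i → s Bool.≤ t → p ⊆ q → insertAt p i s ⊆ insertAt q i t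
insertAt-⊆ zero s≤t p⊆q = ∷-⊆ s≤t p⊆q
insertAt-⊆ {p = _ ∷ _} {_ ∷ _} (suc i) s≤t p⊆q =
  ∷-⊆ (∷-⊆⇒≤ p⊆q) (insertAt-⊆ i s≤t (drop-∷-⊆ p⊆q))

∣insertAt∣ : ∀ (p : Subset n) i b → ∣ insertAt p i b ∣ ≡ ∣ b ∷ p ∣
∣insertAt∣ p             zero    b       = refl
∣insertAt∣ (outside ∷ p) (suc i) b       = ∣insertAt∣ p i b
∣insertAt∣ (inside ∷ p)  (suc i) outside = cong suc (∣insertAt∣ p i outside)
∣insertAt∣ (inside ∷ p)  (suc i) inside  = cong suc (∣insertAt∣ p i inside)

atLeast2 : ℕ → Bool
atLeast2 (suc (suc _)) = true
atLeast2 _             = false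

atLeast2-mono : ∀ {k l} → k ≤ l → atLeast2 k Bool.≤ atLeast2 l
atLeast2-mono {0}           _             = Bool.≤-minimum _
atLeast2-mono {1}           _             = Bool.≤-minimum _
atLeast2-mono {suc (suc _)} (s≤s (s≤s _)) = Bool.b≤b

-- Coordinate 0 is always set, coordinate suc q flags ∣X∣ ≥ 2, and X fills the others.
lift : Fin (suc n) → Subset n → Subset (suc (suc n))
lift q X = inside ∷ insertAt X q (atLeast2 ∣ X ∣)

module _ (q : Fin (suc n)) where

  lift-injective : Injective _≡_ _≡_ (lift q)
  lift-injective {X} {Y} e = begin
    X                                          ≡⟨ removeAt-insertAt X q _ ⟨
    removeAt (insertAt X q (atLeast2 ∣ X ∣)) q ≡⟨ cong (λ Z → removeAt (tail Z) q) e ⟩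
    removeAt (insertAt Y q (atLeast2 ∣ Y ∣)) q ≡⟨ removeAt-insertAt Y q _ ⟩
    Y                                          ∎
    where open ≡-Reasoning

  lift-mono : ∀ {X Y : Subset n} → X ⊆ Y → lift q X ⊆ lift q Y
  lift-mono X⊆Y = s⊆s (insertAt-⊆ q (atLeast2-mono (p⊆q⇒∣p∣≤∣q∣ X⊆Y)) X⊆Y)

  ∣lift∣≢3 : ∀ X → ∣ lift q X ∣ ≢ 3
  ∣lift∣≢3 X rewrite ∣insertAt∣ X q (atLeast2 ∣ X ∣) with ∣ X ∣
  ... | 0           = λ ()
  ... | 1           = λ ()
  ... | suc (suc _) = λ ()

  ∣lift∣≡2⇒¬atLeast2 : ∀ X → ∣ lift q X ∣ ≡ 2 → atLeast2 ∣ X ∣ ≡ false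
  ∣lift∣≡2⇒¬atLeast2 X rewrite ∣insertAt∣ X q (atLeast2 ∣ X ∣) with ∣ X ∣
  ... | 0           = λ _ → refl
  ... | 1           = λ _ → refl
  ... | suc (suc _) = λ ()

  ∣lift∣≡2⇒suc-q∉lift : ∀ X → ∣ lift q X ∣ ≡ 2 → suc q ∉ lift q X
  ∣lift∣≡2⇒suc-q∉lift X ∣lift∣≡2 (there q∈) with () ←
    trans (sym ([]=⇒lookup q∈)) (trans (insertAt-lookup X q _) (∣lift∣≡2⇒¬atLeast2 X ∣lift∣≡2))

  Qₙ⊑R : {F : Family (suc (suc n))} → F ⊆Layer 2 →
         (∀ {A} → F A → zero ∈ A → suc q ∈ A) → WeakSubposet n (RFam F)
  Qₙ⊑R {F} layer q∈edges-at-0 = lift q , lift-injective , lift∈R , λ _ _ → lift-mono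
    where
    lift∈R : ∀ X → RFam F (lift q X)
    lift∈R X (inj₁ ())
    lift∈R X (inj₂ (inj₁ F-lift)) =
      ∣lift∣≡2⇒suc-q∉lift X (layer _ F-lift) (q∈edges-at-0 F-lift here)
    lift∈R X (inj₂ (inj₂ ∣lift∣≡3)) = ∣lift∣≢3 X ∣lift∣≡3

-- ¬¬ because it is not decidable whether some member of F contains the point 0.
PairwiseDisjoint⇒¬¬Qₙ⊑R : {F : Family (suc (suc n))} → F ⊆Layer 2 → PairwiseDisjoint F →
                          ¬ ¬ WeakSubposet n (RFam F)
PairwiseDisjoint⇒¬¬Qₙ⊑R {F = F} layer disjoint ¬Qₙ⊑R =
  ¬Qₙ⊑R (Qₙ⊑R zero layer λ FA 0∈A → contradiction 0∈A (0-uncovered FA))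
  where
  0-uncovered : ∀ {A} → F A → zero ∉ A
  0-uncovered {inside ∷ A} FA here
    with q , q∈A ← 0<∣p∣⇒Nonempty A (≤-reflexive (sym (suc-injective (layer _ FA))))
    = ¬Qₙ⊑R (Qₙ⊑R q layer λ FB 0∈B → subst (suc q ∈_) (disjoint FA FB here 0∈B) (there q∈A))

claim6 : (n : ℕ) → 1 ≤ n →
    (¬ (Σ (Family (n + 2)) λ F → (F ⊆Layer 2)
    × (∀ (S : Subset (n + 2)) → ∣ S ∣ ≡ 1 → AtLeast2Supersets F S)
    × (∀ (T : Subset (n + 2)) → ∣ T ∣ ≡ 3 → AtMost1Subset F T)))
    × (¬ (Σ (Family (n + 2)) λ F → (F ⊆Layer 2)
    × ¬ WeakSubposet 2 (BFam F)
    × ¬ WeakSubposet n (RFam F)))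
claim6 n _ rewrite +-comm n 2 =
    (λ (F , layer , supersets , atMost1) →
      PairwiseDisjoint⇒¬AtLeast2Supersets (atMost1Subset⇒PairwiseDisjoint layer atMost1)
        zero (supersets ⁅ zero ⁆ (∣⁅x⁆∣≡1 {suc (suc n)} zero)))
  , (λ (F , layer , ¬Q₂⊑B , ¬Qₙ⊑R) →
      PairwiseDisjoint⇒¬¬Qₙ⊑R layer (¬Q₂⊑B⇒PairwiseDisjoint layer ¬Q₂⊑B) ¬Qₙ⊑R)
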